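{- For every graph $G$, every peripheral vertex of the injective hull $\mathcal{H}(G)$ is a real vertex (i.e., belongs to $V(G)$).
   Context: All graphs are finite, simple, undirected, unweighted and connected. A graph is Helly if every family of pairwise intersecting disks $D(v,r)=\{u: d(u,v)\le r\}$ has a common vertex. The injective hull $\mathcal{H}(G)$ is the unique minimal Helly graph containing $G$ as an isometric subgraph; vertices of its copy of $G$ are called real, the others Helly vertices. In a graph, $I(y,x)=\{u: d(y,u)+d(u,x)=d(y,x)\}$; a vertex $x$ is peripheral if there is a vertex $y$ such that $I(y,x)\not\subset I(y,z)$ for all vertices $z\ne x$. -}

module Defs where

open import Data.Nat using (ℕ; zero; suc; _≤_; _<_; _+_)
open import Data.Fin using (Fin)
open import Data.Bool using (Bool; true; false)
open import Data.Product using (Σ; ∃; _×_; _,_)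
open import Relation.Binary.PropositionalEquality using (_≡_)
open import Relation.Nullary using (¬_)
open import Function.Bundles using (_⇔_)

record Graph (n : ℕ) : Set where
  field
    adj   : Fin n → Fin n → Bool
    sym   : ∀ u v → adj u v ≡ adj v u
    irrefl : ∀ u → adj u u ≡ false
open Graph public

-- Vertex subsets, as characteristic functions.  The graph itself is the
-- subset 'all'; induced subgraphs H[S] are handled by restricting all
-- notions to vertices of S.
Subset : ℕ → Set
Subset n = Fin n → Bool

all : ∀ {n} → Subset n
all _ = true

_∈_ : ∀ {n} → Fin n → Subset n → Set
v ∈ S = S v ≡ true

data Walk {n : ℕ} (G : Graph n) (S : Subset n) : ℕ → Fin n → Fin n → Set where
  here : ∀ {u} → u ∈ S → Walk G S 0 u u
  step : ∀ {k u w v} → u ∈ S → adj G u w ≡ true → Walk G S k w v → Walk G S (suc k) u v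

IsDist : ∀ {n} → Graph n → Subset n → Fin n → Fin n → ℕ → Set
IsDist G S u v d = Walk G S d u v × (∀ k → k < d → ¬ Walk G S k u v)

Connected : ∀ {n} → Graph n → Subset n → Set
Connected G S = ∀ u v → u ∈ S → v ∈ S → ∃ λ k → Walk G S k u v

InDisk : ∀ {n} → Graph n → Subset n → Fin n → ℕ → Fin n → Set
InDisk G S c r u = u ∈ S × ∃ λ d → IsDist G S c u d × d ≤ r

Helly : ∀ {n} → Graph n → Subset n → Set
Helly G S = ∀ (m : ℕ) (c : Fin m → _) (r : Fin m → ℕ) →
  (∀ i → c i ∈ S) →
  (∀ i j → ∃ λ u → InDisk G S (c i) (r i) u × InDisk G S (c j) (r j) u) →
  ∃ λ u → ∀ i → InDisk G S (c i) (r i) u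

IsometricInto : ∀ {n m} → Graph n → Graph m → Subset m → (Fin n → Fin m) → Set
IsometricInto G H S φ =
  (∀ v → φ v ∈ S) × (∀ u v d → IsDist G all u v d ⇔ IsDist H S (φ u) (φ v) d)

-- H (with isometric copy φ of G) is the injective hull of G:
-- H is a connected Helly graph containing G isometrically, and it is
-- minimal: no proper induced subgraph of H containing φ(G) is a
-- connected Helly graph containing G isometrically (via φ).
IsInjectiveHull : ∀ {n m} → Graph n → Graph m → (Fin n → Fin m) → Set
IsInjectiveHull {m = m} G H φ =
  Connected H all × Helly H all × IsometricInto G H all φ ×
  (∀ (S : Subset m) → Connected H S → Helly H S → IsometricInto G H S φ →
     ∀ v → v ∈ S)

InInterval : ∀ {n} → Graph n → Fin n → Fin n → Fin n → Set
InInterval G y x u = ∃ λ a → ∃ λ b → ∃ λ c →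
  IsDist G all y u a × IsDist G all u x b × IsDist G all y x c × (a + b ≡ c)

Peripheral : ∀ {n} → Graph n → Fin n → Set
Peripheral G x = ∃ λ y → ∀ z → ¬ z ≡ x →
  ¬ (∀ u → InInterval G y x u → InInterval G y z u)

module Submission where

-- Let y witness that x is peripheral in the injective hull H.  Since
-- d(y,z) = d(y,x) + d(x,z) implies I(y,x) ⊆ I(y,z), peripherality gives
--   (★)  d(y,z) < d(y,x) + d(x,z)   for every z ≠ x.
-- Suppose x is not real; then some real vertex differs from x and (★)
-- forces d(y,x) = k + 1.  By (★) every disk containing x meets D(y,k),
-- which avoids x; so by the Helly property any disks centred off x that
-- share x also share a point ≠ x ("escape").  Escape reroutes geodesics
-- around x and supplies common points off x, so H − x is an isometric,
-- connected, Helly subgraph of H containing the copy of G, contradicting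
-- the minimality of the injective hull.

open import Defs hiding (sym)
open import Data.Nat using (ℕ; zero; suc; _+_; _≤_; _<_; z≤n)
open import Data.Nat.Properties
  using ( ≤-pred; ≤-trans; ≤-antisym; <-cmp; <-irrefl; ≮⇒≥; <⇒≱; ≤∧≢⇒<; 1+n≰n; n≤0⇒n≡0
        ; m≤n⇒m<n∨m≡n; +-suc; +-identityʳ; +-comm; +-assoc
        ; +-mono-≤; +-monoˡ-≤; +-monoʳ-≤; +-cancelʳ-≤; module ≤-Reasoning )
open import Relation.Binary using (tri<; tri≈; tri>)
open import Data.Fin using (Fin; _≟_) renaming (zero to fzero; suc to fsuc)
open import Data.Fin.Properties using (any?)
open import Data.Bool using (true; not) renaming (_≟_ to _≟ᵇ_)
open import Data.Product using (∃; _×_; _,_; proj₁; proj₂)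
open import Data.Sum using (inj₁; inj₂)
open import Data.Empty using (⊥-elim)
open import Data.Vec.Functional using (_∷_; [])
open import Relation.Nullary using (¬_; Dec; yes; no; does)
open import Relation.Nullary.Decidable using (_×-dec_)
open import Relation.Binary.PropositionalEquality
  using (_≡_; refl; sym; trans; cong; cong₂; subst)
open import Function.Bundles using (_⇔_; mk⇔; Equivalence)
import Function.Properties.Equivalence as ⇔

module Walks {m : ℕ} (H : Graph m) (S : Subset m) where

  walk? : ∀ k u v → Dec (Walk H S k u v)
  walk? zero u v with u ≟ v
  ... | no u≢v = no λ { (here _) → u≢v refl }
  ... | yes refl with S u ≟ᵇ true
  ...   | yes u∈S = yes (here u∈S)
  ...   | no u∉S = no λ { (here u∈S) → u∉S u∈S }
  walk? (suc k) u v with S u ≟ᵇ true | any? (λ w → (adj H u w ≟ᵇ true) ×-dec walk? k w v)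
  ... | yes u∈S | yes (w , u~w , walk) = yes (step u∈S u~w walk)
  ... | no u∉S  | _ = no λ { (step u∈S _ _) → u∉S u∈S }
  ... | _       | no none = no λ { (step _ u~w walk) → none (_ , u~w , walk) }

  shortest-from : ∀ {u v} j t → (∀ k → k < j → ¬ Walk H S k u v) →
    Walk H S (t + j) u v → ∃ λ d → IsDist H S u v d
  shortest-from {u} {v} j t none walk with walk? j u v
  ... | yes found = j , found , none
  ... | no missing with t
  ...   | zero = ⊥-elim (missing walk)
  ...   | suc t′ = shortest-from (suc j) t′ none′ (subst (λ l → Walk H S l u v) (sym (+-suc t′ j)) walk)
    where
    none′ : ∀ k → k < suc j → ¬ Walk H S k u v
    none′ k k<1+j with m≤n⇒m<n∨m≡n (≤-pred k<1+j)
    ... | inj₁ k<j = none k k<j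
    ... | inj₂ refl = missing

  distance : ∀ {k u v} → Walk H S k u v → ∃ λ d → IsDist H S u v d
  distance {k} {u} {v} walk =
    shortest-from 0 k (λ _ ()) (subst (λ l → Walk H S l u v) (sym (+-identityʳ k)) walk)

  isDist-unique : ∀ {u v d d′} → IsDist H S u v d → IsDist H S u v d′ → d ≡ d′
  isDist-unique {d = d} {d′} (walk , short) (walk′ , short′) with <-cmp d d′
  ... | tri< d<d′ _ _ = ⊥-elim (short′ d d<d′ walk)
  ... | tri≈ _ d≡d′ _ = d≡d′
  ... | tri> _ _ d′<d = ⊥-elim (short d′ d′<d walk′)

  isDist≤walk : ∀ {u v d k} → IsDist H S u v d → Walk H S k u v → d ≤ k
  isDist≤walk (_ , short) walk = ≮⇒≥ λ k<d → short _ k<d walk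

  snoc : ∀ {k u v w} → Walk H S k u v → adj H v w ≡ true → w ∈ S → Walk H S (suc k) u w
  snoc (here u∈S) v~w w∈S = step u∈S v~w (here w∈S)
  snoc (step u∈S u~a walk) v~w w∈S = step u∈S u~a (snoc walk v~w w∈S)

  reverse : ∀ {k u v} → Walk H S k u v → Walk H S k v u
  reverse (here u∈S) = here u∈S
  reverse (step {u = u} {w = w} u∈S u~w walk) = snoc (reverse walk) (trans (Graph.sym H w u) u~w) u∈S

  append : ∀ {k l u v w} → Walk H S k u v → Walk H S l v w → Walk H S (k + l) u w
  append (here _) walk₂ = walk₂
  append (step u∈S u~a walk₁) walk₂ = step u∈S u~a (append walk₁ walk₂)

walk-in-all : ∀ {m} {H : Graph m} {S : Subset m} {k u v} → Walk H S k u v → Walk H all k u v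
walk-in-all (here _) = here refl
walk-in-all (step _ u~w walk) = step refl u~w (walk-in-all walk)

module Metric {m : ℕ} (H : Graph m) (connected : Connected H all) where
  open Walks H all

  opaque
    dist-exists : ∀ u v → ∃ λ d → IsDist H all u v d
    dist-exists u v = distance (proj₂ (connected u v refl refl))

  dist : Fin m → Fin m → ℕ
  dist u v = proj₁ (dist-exists u v)

  isDist : ∀ u v → IsDist H all u v (dist u v)
  isDist u v = proj₂ (dist-exists u v)

  isDist⇒≡dist : ∀ {u v d} → IsDist H all u v d → d ≡ dist u v
  isDist⇒≡dist is = isDist-unique is (isDist _ _)

  dist≤walk : ∀ {k u v} → Walk H all k u v → dist u v ≤ k
  dist≤walk = isDist≤walk (isDist _ _)

  geodesic : ∀ {u v d} → dist u v ≡ d → Walk H all d u v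
  geodesic {u} {v} refl = proj₁ (isDist u v)

  dist-refl : ∀ u → dist u u ≡ 0
  dist-refl u = n≤0⇒n≡0 (dist≤walk (here refl))

  dist-refl≤ : ∀ u r → dist u u ≤ r
  dist-refl≤ u r = subst (_≤ r) (sym (dist-refl u)) z≤n

  dist≡0⇒≡ : ∀ {u v} → dist u v ≡ 0 → u ≡ v
  dist≡0⇒≡ d≡0 with geodesic d≡0
  ... | here _ = refl

  dist-sym : ∀ u v → dist u v ≡ dist v u
  dist-sym u v = ≤-antisym (dist≤walk (reverse (geodesic refl))) (dist≤walk (reverse (geodesic refl)))

  triangle : ∀ u v w → dist u w ≤ dist u v + dist v w
  triangle u v w = dist≤walk (append (geodesic refl) (geodesic refl))

  adj⇒dist≤1 : ∀ {u v} → adj H u v ≡ true → dist u v ≤ 1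
  adj⇒dist≤1 u~v = dist≤walk (step refl u~v (here refl))

  dist≡1⇒adj : ∀ {u v} → dist u v ≡ 1 → adj H u v ≡ true
  dist≡1⇒adj d≡1 with geodesic d≡1
  ... | step _ u~v (here _) = u~v

  geodesic-step : ∀ {a b t} → dist a b ≡ suc t → ∃ λ a′ → adj H a a′ ≡ true × dist a′ b ≡ t
  geodesic-step {a} {b} {t} d≡1+t with geodesic d≡1+t
  ... | step {w = a′} _ a~a′ walk = a′ , a~a′ , ≤-antisym (dist≤walk walk) (≤-pred 1+t≤)
    where
    open ≤-Reasoning
    1+t≤ : suc t ≤ suc (dist a′ b)
    1+t≤ = begin
      suc t                  ≡⟨ sym d≡1+t ⟩
      dist a b               ≤⟨ triangle a a′ b ⟩
      dist a a′ + dist a′ b  ≤⟨ +-monoˡ-≤ (dist a′ b) (adj⇒dist≤1 a~a′) ⟩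
      suc (dist a′ b)        ∎

  split : ∀ p q a b → dist a b ≤ p + q → ∃ λ w → dist a w ≤ p × dist b w ≤ q
  split zero q a b ab≤q = a , dist-refl≤ a 0 , subst (_≤ q) (dist-sym a b) ab≤q
  split (suc p) q a b ab≤ with dist a b in ab
  ... | zero = a , dist-refl≤ a (suc p) , subst (_≤ q) (dist-sym a b) (subst (_≤ q) (sym ab) z≤n)
  ... | suc t with geodesic-step ab
  ...   | a′ , a~a′ , a′b≡t with split p q a′ b (subst (_≤ p + q) (sym a′b≡t) (≤-pred ab≤))
  ...     | w , a′w≤p , bw≤q = w , ≤-trans (triangle a a′ w) (+-mono-≤ (adj⇒dist≤1 a~a′) a′w≤p) , bw≤q

  squeeze : ∀ {u v w b t} → dist u v ≡ suc (suc t) → dist b v ≡ t →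
    dist u w ≤ 1 → dist b w ≤ 1 → dist u w ≡ 1 × dist w v ≡ suc t
  squeeze {u} {v} {w} {b} {t} uv bv uw≤1 bw≤1 = uw≡1 , wv≡1+t
    where
    open ≤-Reasoning
    wv≤ : dist w v ≤ suc t
    wv≤ = begin
      dist w v             ≤⟨ triangle w b v ⟩
      dist w b + dist b v  ≡⟨ cong₂ _+_ (dist-sym w b) bv ⟩
      dist b w + t         ≤⟨ +-monoˡ-≤ t bw≤1 ⟩
      suc t                ∎
    2+t≤ : suc (suc t) ≤ dist u w + dist w v
    2+t≤ = subst (_≤ dist u w + dist w v) uv (triangle u w v)
    wv≡1+t : dist w v ≡ suc t
    wv≡1+t = ≤-antisym wv≤ (≤-pred (≤-trans 2+t≤ (+-monoˡ-≤ (dist w v) uw≤1)))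
    uw≡1 : dist u w ≡ 1
    uw≡1 = ≤-antisym uw≤1 (+-cancelʳ-≤ (suc t) 1 (dist u w) (≤-trans 2+t≤ (+-monoʳ-≤ (dist u w) wv≤)))

  helly : Helly H all → ∀ k (c : Fin k → Fin m) (r : Fin k → ℕ) →
    (∀ i j → ∃ λ u → dist (c i) u ≤ r i × dist (c j) u ≤ r j) →
    ∃ λ u → ∀ i → dist (c i) u ≤ r i
  helly hel k c r pairwise with hel k c r (λ _ → refl) (λ i j → in-disks (pairwise i j))
    where
    in-disks : ∀ {a b ra rb} → (∃ λ u → dist a u ≤ ra × dist b u ≤ rb) →
      ∃ λ u → InDisk H all a ra u × InDisk H all b rb u
    in-disks (u , au , bu) = u , (refl , _ , isDist _ _ , au) , (refl , _ , isDist _ _ , bu)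
  ... | u , common = u , λ i → from-disk (common i)
    where
    from-disk : ∀ {c r} → InDisk H all c r u → dist c u ≤ r
    from-disk (_ , _ , is , le) = subst (_≤ _) (isDist⇒≡dist is) le

  interval-extends : ∀ {y x z} → dist y z ≡ dist y x + dist x z →
    ∀ u → InInterval H y x u → InInterval H y z u
  interval-extends {y} {x} {z} yz u (a , b , c , ya , bx , yx , a+b≡c) =
    dist y u , dist u z , dist y z , isDist y u , isDist u z , isDist y z ,
    ≤-antisym yu+uz≤yz (triangle y u z)
    where
    open ≤-Reasoning
    yu+ux : dist y u + dist u x ≡ dist y x
    yu+ux = trans (cong₂ _+_ (sym (isDist⇒≡dist ya)) (sym (isDist⇒≡dist bx)))
                  (trans a+b≡c (isDist⇒≡dist yx))
    yu+uz≤yz : dist y u + dist u z ≤ dist y z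
    yu+uz≤yz = begin
      dist y u + dist u z               ≤⟨ +-monoʳ-≤ (dist y u) (triangle u x z) ⟩
      dist y u + (dist u x + dist x z)  ≡⟨ sym (+-assoc (dist y u) _ _) ⟩
      dist y u + dist u x + dist x z    ≡⟨ cong (_+ dist x z) yu+ux ⟩
      dist y x + dist x z               ≡⟨ sym yz ⟩
      dist y z                          ∎

  Detour : Fin m → Fin m → Set
  Detour y x = ∀ z → ¬ z ≡ x → dist y z < dist y x + dist x z

  peripheral⇒detour : ∀ {y x} →
    (∀ z → ¬ z ≡ x → ¬ (∀ u → InInterval H y x u → InInterval H y z u)) → Detour y x
  peripheral⇒detour {y} {x} notContained z z≢x =
    ≤∧≢⇒< (triangle y x z) λ yz → notContained z z≢x (interval-extends yz)

  detour⇒positive : ∀ {y x z} → Detour y x → ¬ z ≡ x → ∃ λ k → dist y x ≡ suc k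
  detour⇒positive {y} {x} {z} detour z≢x with dist y x in yx
  ... | suc k = k , refl
  ... | zero with dist≡0⇒≡ yx
  ...   | refl = ⊥-elim (<-irrefl refl (detour z z≢x))

punctured : ∀ {m} → Fin m → Subset m
punctured x v = not (does (v ≟ x))

≢⇒∈punctured : ∀ {m} {x v : Fin m} → ¬ v ≡ x → v ∈ punctured x
≢⇒∈punctured {x = x} {v} v≢x with v ≟ x
... | yes v≡x = ⊥-elim (v≢x v≡x)
... | no _ = refl

∈punctured⇒≢ : ∀ {m} {x v : Fin m} → v ∈ punctured x → ¬ v ≡ x
∈punctured⇒≢ {x = x} {v} v∈T v≡x with v ≟ x
∈punctured⇒≢ () _ | yes _
... | no v≢x = v≢x v≡x

isometric-restrict : ∀ {n m} {G : Graph n} {H : Graph m} {T : Subset m} {φ : Fin n → Fin m} →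
  IsometricInto G H all φ → (∀ v → φ v ∈ T) →
  (∀ {u v d} → u ∈ T → v ∈ T → IsDist H T u v d ⇔ IsDist H all u v d) →
  IsometricInto G H T φ
isometric-restrict (_ , iso) φ∈T same =
  φ∈T , λ u v d → ⇔.trans (iso u v d) (⇔.sym (same (φ∈T u) (φ∈T v)))

module Removal {m : ℕ} (H : Graph m) (connected : Connected H all) (hel : Helly H all)
  (x y : Fin m) (k : ℕ) (yx : Metric.dist H connected y x ≡ suc k)
  (detour : Metric.Detour H connected y x) where
  open Metric H connected

  T : Subset m
  T = punctured x

  near : ∀ z r → ¬ z ≡ x → dist z x ≤ r → ∃ λ w → dist y w ≤ k × dist z w ≤ r
  near z r z≢x zx≤r with split r k z y zy≤
    where
    open ≤-Reasoning
    zy≤ : dist z y ≤ r + k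
    zy≤ = begin
      dist z y      ≡⟨ dist-sym z y ⟩
      dist y z      ≤⟨ ≤-pred (subst (λ t → dist y z < t + dist x z) yx (detour z z≢x)) ⟩
      k + dist x z  ≡⟨ cong (k +_) (dist-sym x z) ⟩
      k + dist z x  ≤⟨ +-monoʳ-≤ k zx≤r ⟩
      k + r         ≡⟨ +-comm k r ⟩
      r + k         ∎
  ... | w , zw≤r , yw≤k = w , yw≤k , zw≤r

  far⇒≢x : ∀ {w} → dist y w ≤ k → ¬ w ≡ x
  far⇒≢x yw≤k refl = 1+n≰n (subst (_≤ k) yx yw≤k)

  escape : ∀ j (c : Fin j → Fin m) (r : Fin j → ℕ) →
    (∀ i → ¬ c i ≡ x) → (∀ i → dist (c i) x ≤ r i) →
    ∃ λ w → ¬ w ≡ x × ∀ i → dist (c i) w ≤ r i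
  escape j c r c≢x cx≤r with helly hel (suc j) (y ∷ c) (k ∷ r) pairwise
    where
    swap : ∀ {a b ra rb} → (∃ λ u → dist a u ≤ ra × dist b u ≤ rb) → ∃ λ u → dist b u ≤ rb × dist a u ≤ ra
    swap (u , au , bu) = u , bu , au
    pairwise : ∀ i i′ → ∃ λ u → dist ((y ∷ c) i) u ≤ (k ∷ r) i × dist ((y ∷ c) i′) u ≤ (k ∷ r) i′
    pairwise fzero fzero = y , dist-refl≤ y k , dist-refl≤ y k
    pairwise fzero (fsuc i) = near (c i) (r i) (c≢x i) (cx≤r i)
    pairwise (fsuc i) fzero = swap (near (c i) (r i) (c≢x i) (cx≤r i))
    pairwise (fsuc i) (fsuc i′) = x , cx≤r i , cx≤r i′
  ... | w , common = w , far⇒≢x (common fzero) , λ i → common (fsuc i)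

  reroute : ∀ {u v b t} → ¬ u ≡ x → adj H u x ≡ true → adj H x b ≡ true →
    dist u v ≡ suc (suc t) → dist b v ≡ t →
    ∃ λ w → ¬ w ≡ x × adj H u w ≡ true × dist w v ≡ suc t
  reroute {u} {v} {b} u≢x u~x x~b uv bv
    with escape 2 (u ∷ b ∷ []) (1 ∷ 1 ∷ []) (λ { fzero → u≢x ; (fsuc fzero) → b≢x })
                (λ { fzero → adj⇒dist≤1 u~x ; (fsuc fzero) → subst (_≤ 1) (dist-sym x b) (adj⇒dist≤1 x~b) })
    where
    b≢x : ¬ b ≡ x
    b≢x refl with trans (sym x~b) (Graph.irrefl H x)
    ... | ()
  ... | w , w≢x , near-both with squeeze uv bv (near-both fzero) (near-both (fsuc fzero))
  ...   | uw≡1 , wv = w , w≢x , dist≡1⇒adj uw≡1 , wv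

  step-avoiding : ∀ {u v t} → ¬ u ≡ x → ¬ v ≡ x → dist u v ≡ suc t →
    ∃ λ w → ¬ w ≡ x × adj H u w ≡ true × dist w v ≡ t
  step-avoiding {u} {v} {t} u≢x v≢x uv with geodesic-step uv
  ... | a , u~a , av with a ≟ x
  ...   | no a≢x = a , a≢x , u~a , av
  ...   | yes refl with t
  ...     | zero = ⊥-elim (v≢x (sym (dist≡0⇒≡ av)))
  ...     | suc t′ with geodesic-step av
  ...       | b , x~b , bv = reroute u≢x u~a x~b uv bv

  geodesic-avoiding : ∀ d {u v} → ¬ u ≡ x → ¬ v ≡ x → dist u v ≡ d → Walk H T d u v
  geodesic-avoiding zero u≢x v≢x uv with dist≡0⇒≡ uv
  ... | refl = here (≢⇒∈punctured u≢x)
  geodesic-avoiding (suc d) u≢x v≢x uv with step-avoiding u≢x v≢x uv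
  ... | w , w≢x , u~w , wv = step (≢⇒∈punctured u≢x) u~w (geodesic-avoiding d w≢x v≢x wv)

  isDist-punctured : ∀ {u v} → u ∈ T → v ∈ T → IsDist H T u v (dist u v)
  isDist-punctured {u} {v} u∈T v∈T =
    geodesic-avoiding (dist u v) (∈punctured⇒≢ u∈T) (∈punctured⇒≢ v∈T) refl ,
    λ l l<d walk → <⇒≱ l<d (dist≤walk (walk-in-all walk))

  punctured-isometric : ∀ {u v d} → u ∈ T → v ∈ T → IsDist H T u v d ⇔ IsDist H all u v d
  punctured-isometric {u} {v} u∈T v∈T = mk⇔
    (λ is → subst (IsDist H all u v) (Walks.isDist-unique H T (isDist-punctured u∈T v∈T) is) (isDist u v))
    (λ is → subst (IsDist H T u v) (sym (isDist⇒≡dist is)) (isDist-punctured u∈T v∈T))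

  punctured-connected : Connected H T
  punctured-connected u v u∈T v∈T = dist u v , proj₁ (isDist-punctured u∈T v∈T)

  -- Disks of H − x are disks of H minus x; a common point in H can be
  -- moved off x by escape.
  punctured-helly : Helly H T
  punctured-helly j c r c∈T pairwise with helly hel j c r pairwise-H
    where
    from-disk : ∀ {c r u} → c ∈ T → InDisk H T c r u → dist c u ≤ r
    from-disk c∈T (u∈T , _ , is , le) =
      subst (_≤ _) (isDist⇒≡dist (Equivalence.to (punctured-isometric c∈T u∈T) is)) le
    pairwise-H : ∀ i i′ → ∃ λ u → dist (c i) u ≤ r i × dist (c i′) u ≤ r i′
    pairwise-H i i′ with pairwise i i′
    ... | u , in-i , in-i′ = u , from-disk (c∈T i) in-i , from-disk (c∈T i′) in-i′
  ... | u , common = common-avoiding (u ≟ x)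
    where
    to-disk : ∀ {w} → ¬ w ≡ x → (∀ i → dist (c i) w ≤ r i) → ∃ λ w → ∀ i → InDisk H T (c i) (r i) w
    to-disk {w} w≢x cw≤r =
      w , λ i → ≢⇒∈punctured w≢x , dist (c i) w , isDist-punctured (c∈T i) (≢⇒∈punctured w≢x) , cw≤r i
    common-avoiding : Dec (u ≡ x) → ∃ λ w → ∀ i → InDisk H T (c i) (r i) w
    common-avoiding (no u≢x) = to-disk u≢x common
    common-avoiding (yes refl) with escape j c r (λ i → ∈punctured⇒≢ (c∈T i)) common
    ... | w , w≢x , cw≤r = to-disk w≢x cw≤r

-- If x were not real, the punctured hull H − x would contradict minimality.
proposition1 : ∀ {n m} (G : Graph (suc n)) (H : Graph m) (φ : Fin (suc n) → Fin m) →
    Connected G all → IsInjectiveHull G H φ →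
    ∀ x → Peripheral H x → ∃ λ v → φ v ≡ x
proposition1 G H φ _ (connected , hel , iso , minimal) x (y , notContained)
  with any? (λ v → φ v ≟ x)
... | yes real = real
... | no unreal = ⊥-elim (x∉T (minimal T punctured-connected punctured-helly φ-isometric x))
  where
  open Metric H connected
  detour : Detour y x
  detour = peripheral⇒detour notContained
  positive : ∃ λ k → dist y x ≡ suc k
  positive = detour⇒positive detour (λ φ0≡x → unreal (fzero , φ0≡x))
  open Removal H connected hel x y (proj₁ positive) (proj₂ positive) detour
  x∉T : ¬ x ∈ T
  x∉T x∈T = ∈punctured⇒≢ {x = x} x∈T refl
  φ-isometric : IsometricInto G H T φ
  φ-isometric = isometric-restrict iso (λ v → ≢⇒∈punctured (λ φv≡x → unreal (v , φv≡x))) punctured-isometric
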